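{- Let $P$ be a logic program with $\mathit{At}(P)=\{x_1,\ldots,x_n\}$ and size $m$. Let $\mathit{stable}^p$ be the algorithm that enumerates a full family of permutations of $\{1,\ldots,n\}$ of cardinality $\binom{n}{\lfloor n/2\rfloor}$, generating each permutation exactly once in $O(n)$ steps from the previous one, and for each generated permutation $\pi$ runs the procedure $\mathit{stable\_aux}(P,\pi)$, which runs in $O(m)$ steps and, for any $j$, outputs $\{x_{\pi(j)},\ldots,x_{\pi(n)}\}$ if and only if this set is a stable model of $P$ (and outputs nothing else). Then $\mathit{stable}^p$ outputs exactly the stable models of $P$ and runs in time $O(m2^n/\sqrt n)$.
   Context: A clause is $p\leftarrow B$ with head atom $p$ and body $B$ a finite set of literals (atoms $a$ or negated atoms $\mathrm{not}(a)$). A logic program is a finite set of clauses; its size $m$ is the total number of occurrences of atoms in it. $M\subseteq\mathit{At}(P)$ is a stable model of $P$ if $M$ is the least model of the Gelfond–Lifschitz reduct $P^M$, obtained by deleting every clause with some $\mathrm{not}(a)$, $a\in M$, in its body and deleting negated literals from the remaining clauses. A collection $\mathcal S$ of permutations of $\{1,\ldots,n\}$ is full if for every subset $S\subseteq\{1,\ldots,n\}$ there is $\pi\in\mathcal S$ with $S=\{\pi(n-|S|+1),\ldots,\pi(n)\}$. -}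

module Defs where

open import Data.Nat using (ℕ; zero; suc; _+_; _*_; _≤?_)
open import Data.Fin using (Fin; toℕ)
open import Data.Fin.Subset using (Subset; _∈_; _∉_; _⊆_; ⊥; ⁅_⁆; _∪_)
open import Data.Fin.Permutation using (Permutation′; _⟨$⟩ʳ_)
open import Data.List using (List; []; _∷_; map; filter; foldr; length; allFin; concatMap)
open import Data.Nat.ListAction using (sum)
open import Data.List.Relation.Unary.All using (All)
open import Data.List.Relation.Unary.Any using (Any)
import Data.List.Membership.Propositional as LM
open import Data.Product using (_×_; Σ; ∃)
open import Relation.Binary.PropositionalEquality using (_≡_)

-- Atoms of a program over At(P) = {x_1,...,x_n} are represented by Fin n
-- (atom x_{i+1} is represented by i : Fin n).

data Literal (n : ℕ) : Set where
  pos : Fin n → Literal n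
  neg : Fin n → Literal n

record Clause (n : ℕ) : Set where
  constructor _←_
  field
    head : Fin n
    body : List (Literal n)
open Clause public

Program : ℕ → Set
Program n = List (Clause n)

-- size: total number of occurrences of atoms in the program
litsSize : ∀ {n} → List (Literal n) → ℕ
litsSize xs = length xs

clauseSize : ∀ {n} → Clause n → ℕ
clauseSize c = suc (length (body c))

size : ∀ {n} → Program n → ℕ
size P = sum (map clauseSize P)

data OccursLit {n} (a : Fin n) : Literal n → Set where
  in-pos : OccursLit a (pos a)
  in-neg : OccursLit a (neg a)

data OccursClause {n} (a : Fin n) (c : Clause n) : Set where
  in-head : head c ≡ a → OccursClause a c
  in-body : Any (OccursLit a) (body c) → OccursClause a c

Occurs : ∀ {n} → Fin n → Program n → Set
Occurs a P = Any (OccursClause a) P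

-- At(P) = {x_1, ..., x_n}: every atom of Fin n occurs in P
AtomsAre : ∀ {n} → Program n → Set
AtomsAre {n} P = (a : Fin n) → Occurs a P

record DClause (n : ℕ) : Set where
  constructor _⇐_
  field
    dhead : Fin n
    dbody : List (Fin n)
open DClause public

data Blocked {n} (M : Subset n) : List (Literal n) → Set where
  here-neg : ∀ {a ls} → a ∈ M → Blocked M (neg a ∷ ls)
  there    : ∀ {l ls} → Blocked M ls → Blocked M (l ∷ ls)

posAtoms : ∀ {n} → List (Literal n) → List (Fin n)
posAtoms [] = []
posAtoms (pos a ∷ ls) = a ∷ posAtoms ls
posAtoms (neg a ∷ ls) = posAtoms ls

InReduct : ∀ {n} → Program n → Subset n → DClause n → Set
InReduct P M d =
  Any (λ c → (¬Blocked c) × (d ≡ (head c ⇐ posAtoms (body c)))) P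
  where
  open import Relation.Nullary using (¬_)
  ¬Blocked : _ → Set
  ¬Blocked c = ¬ Blocked M (body c)

ModelOfReduct : ∀ {n} → Program n → Subset n → Subset n → Set
ModelOfReduct P M X =
  ∀ d → InReduct P M d → All (_∈ X) (dbody d) → dhead d ∈ X

LeastModelOfReduct : ∀ {n} → Program n → Subset n → Set
LeastModelOfReduct P M =
  ModelOfReduct P M M × (∀ X → ModelOfReduct P M X → M ⊆ X)

Stable : ∀ {n} → Program n → Subset n → Set
Stable P M = LeastModelOfReduct P M

-- suffix π j = { π(i) | j ≤ i }  (0-indexed).  In the paper's 1-indexed
-- notation, {x_π(j+1), ..., x_π(n)} = suffix π j.
suffix : ∀ {n} → Permutation′ n → ℕ → Subset n
suffix {n} π j =
  foldr _∪_ ⊥ (map (λ i → ⁅ π ⟨$⟩ʳ i ⁆) (filter (λ i → j ≤? toℕ i) (allFin n)))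

open import Data.Fin.Subset using (∣_∣) public
open import Data.Nat using (_∸_)

Full : ∀ {n} → List (Permutation′ n) → Set
Full {n} 𝒮 = (S : Subset n) → Any (λ π → S ≡ suffix π (n ∸ ∣ S ∣)) 𝒮

Distinct : ∀ {n} → Permutation′ n → Permutation′ n → Set
Distinct {n} π σ = (∀ i → π ⟨$⟩ʳ i ≡ σ ⟨$⟩ʳ i) → Data.Empty.⊥
  where import Data.Empty

outputs : ∀ {n} → List (Permutation′ n) → (Permutation′ n → List (Subset n)) → List (Subset n)
outputs 𝒮 aux = concatMap aux 𝒮

runningTime : ∀ {n} → List (Permutation′ n) → (Permutation′ n → ℕ) → (Permutation′ n → ℕ) → ℕ
runningTime 𝒮 genTime auxTime = sum (map (λ π → genTime π + auxTime π) 𝒮)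

StableAuxSpec : ∀ {n} → Program n → (Permutation′ n → List (Subset n)) → Set
StableAuxSpec {n} P aux =
  ∀ π (S : Subset n) →
    (LM._∈_ S (aux π) → Σ ℕ (λ j → (S ≡ suffix π j) × Stable P S)) ×
    ((j : ℕ) → S ≡ suffix π j → Stable P S → LM._∈_ S (aux π))

{-# OPTIONS --safe #-}
module Submission where

-- Every set output by stable_aux is a stable model, and conversely a stable
-- model S, being the suffix of length |S| of some π in the full family, is
-- output by stable_aux(P, π).  Since every atom occurs in P we have n ≤ m, so
-- the running time is at most C(n,⌊n/2⌋) (c₁ + c₂) m, and the central binomial
-- coefficient satisfies C(n,⌊n/2⌋)² n ≤ 4ⁿ.  For n = 2k this follows from
-- C(2k,k)² (3k+1) ≤ 16ᵏ, proved by induction from (k+1) C(2k+2,k+1) = 2 (2k+1) C(2k,k);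
-- for n = 2k+1 from C(2k+2,k+1) = 2 C(2k+1,k).

open import Defs
open import Data.Nat using (ℕ; zero; suc; _+_; _*_; _^_; _∸_; _≤_; _<_; z≤n; s≤s; _/_)
open import Data.Nat.Properties
open import Data.Nat.Combinatorics using (_C_; nC1≡n; nCk≡nC[n∸k]; nCk+nC[k+1]≡[n+1]C[k+1])
open import Data.Nat.DivMod using (_%_; m≡m%n+[m/n]*n; m%n<n)
open import Data.Nat.ListAction using (sum)
open import Data.Nat.Tactic.RingSolver using (solve-∀; solve)
open import Data.Fin using (Fin)
open import Data.Fin.Properties using (injective⇒≤)
open import Data.Fin.Subset using (Subset)
open import Data.Fin.Permutation using (Permutation′)
open import Data.List using (List; []; _∷_; map; length; lookup; concatMap)
open import Data.List.Properties using (length-++; length-map)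
open import Data.List.Relation.Unary.Any as Any using (Any; here; there; satisfied)
open import Data.List.Relation.Unary.Any.Properties using (lookup-index; map⁺)
open import Data.List.Relation.Unary.AllPairs using (AllPairs)
open import Data.List.Membership.Propositional using (_∈_)
open import Data.List.Membership.Propositional.Properties using (∈-concatMap⁺; ∈-concatMap⁻)
open import Data.Product using (_×_; ∃; _,_; proj₁; proj₂)
open import Function.Base using (_∘_)
open import Function.Bundles using (_⇔_; mk⇔)
open import Relation.Binary.PropositionalEquality

[1+k]*[1+n]C[1+k]≡[1+n]*nCk : ∀ n k → suc k * (suc n C suc k) ≡ suc n * (n C k)
[1+k]*[1+n]C[1+k]≡[1+n]*nCk zero    zero    = refl
[1+k]*[1+n]C[1+k]≡[1+n]*nCk zero    (suc k) = *-zeroʳ (suc (suc k))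
[1+k]*[1+n]C[1+k]≡[1+n]*nCk (suc n) zero    =
  trans (+-identityʳ _) (trans (nC1≡n (suc (suc n))) (sym (*-identityʳ _)))
[1+k]*[1+n]C[1+k]≡[1+n]*nCk (suc n) (suc k) = begin
  suc (suc k) * (suc (suc n) C suc (suc k))   ≡⟨ cong (suc (suc k) *_) (nCk+nC[k+1]≡[n+1]C[k+1] (suc n) (suc k)) ⟨
  suc (suc k) * (A + B)                       ≡⟨ distribute k A B ⟩
  A + (suc k * A + suc (suc k) * B)           ≡⟨ cong₂ (λ x y → A + (x + y)) ([1+k]*[1+n]C[1+k]≡[1+n]*nCk n k)
                                                                            ([1+k]*[1+n]C[1+k]≡[1+n]*nCk n (suc k)) ⟩
  A + (suc n * (n C k) + suc n * (n C suc k)) ≡⟨ cong (A +_) (*-distribˡ-+ (suc n) (n C k) _) ⟨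
  A + suc n * (n C k + n C suc k)             ≡⟨ cong (λ x → A + suc n * x) (nCk+nC[k+1]≡[n+1]C[k+1] n k) ⟩
  suc (suc n) * A                             ∎
  where
  open ≡-Reasoning
  A = suc n C suc k
  B = suc n C suc (suc k)
  distribute : ∀ k A B → suc (suc k) * (A + B) ≡ A + (suc k * A + suc (suc k) * B)
  distribute = solve-∀

[1+2k]Ck≡[1+2k]C[1+k] : ∀ k → suc (k * 2) C k ≡ suc (k * 2) C suc k
[1+2k]Ck≡[1+2k]C[1+k] k =
  trans (nCk≡nC[n∸k] (≤-trans (m≤m+n k (suc k)) (≤-reflexive (sym 1+2k≡k+[1+k]))))
        (cong (suc (k * 2) C_) (trans (cong (_∸ k) 1+2k≡k+[1+k]) (m+n∸m≡n k (suc k))))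
  where
  1+2k≡k+[1+k] : suc (k * 2) ≡ k + suc k
  1+2k≡k+[1+k] = solve (k ∷ [])

[2+2k]C[1+k]≡[1+2k]Ck+[1+2k]Ck : ∀ k → suc k * 2 C suc k ≡ suc (k * 2) C k + suc (k * 2) C k
[2+2k]C[1+k]≡[1+2k]Ck+[1+2k]Ck k = begin
  suc (suc (k * 2)) C suc k                   ≡⟨ nCk+nC[k+1]≡[n+1]C[k+1] (suc (k * 2)) k ⟨
  suc (k * 2) C k + suc (k * 2) C suc k       ≡⟨ cong (suc (k * 2) C k +_) ([1+2k]Ck≡[1+2k]C[1+k] k) ⟨
  suc (k * 2) C k + suc (k * 2) C k           ∎
  where open ≡-Reasoning

[1+k]*[1+2k]Ck≡[1+2k]*2kCk : ∀ k → suc k * (suc (k * 2) C k) ≡ suc (k * 2) * (k * 2 C k)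
[1+k]*[1+2k]Ck≡[1+2k]*2kCk k =
  trans (cong (suc k *_) ([1+2k]Ck≡[1+2k]C[1+k] k)) ([1+k]*[1+n]C[1+k]≡[1+n]*nCk (k * 2) k)

-- Here c = C(2k,k), d = C(2k+1,k) and q = 4ᵏ; the step rests on (2k+1)² (3k+4) + k = 4 (k+1)² (3k+1).
central-step : ∀ k c d q → suc k * d ≡ suc (k * 2) * c → c * c * (1 + 3 * k) ≤ q * q →
               (d + d) * (d + d) * (1 + 3 * suc k) ≤ 2 * (2 * q) * (2 * (2 * q))
central-step k c d q [1+k]d≡[1+2k]c c²[1+3k]≤q² = *-cancelˡ-≤ (suc k * suc k) (begin
  suc k * suc k * ((d + d) * (d + d) * (1 + 3 * suc k))    ≡⟨ solve (k ∷ d ∷ []) ⟩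
  4 * ((suc k * d) * (suc k * d)) * (4 + 3 * k)             ≡⟨ cong (λ x → 4 * (x * x) * (4 + 3 * k)) [1+k]d≡[1+2k]c ⟩
  4 * ((suc (k * 2) * c) * (suc (k * 2) * c)) * (4 + 3 * k) ≤⟨ m≤m+n _ (4 * k * (c * c)) ⟩
  4 * ((suc (k * 2) * c) * (suc (k * 2) * c)) * (4 + 3 * k)
    + 4 * k * (c * c)                                       ≡⟨ solve (k ∷ c ∷ []) ⟩
  suc k * suc k * (16 * (c * c * (1 + 3 * k)))              ≤⟨ *-monoʳ-≤ (suc k * suc k) (*-monoʳ-≤ 16 c²[1+3k]≤q²) ⟩
  suc k * suc k * (16 * (q * q))                            ≡⟨ solve (k ∷ q ∷ []) ⟩
  suc k * suc k * (2 * (2 * q) * (2 * (2 * q)))             ∎)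
  where open ≤-Reasoning

[2kCk]²*[1+3k]≤[2^2k]² : ∀ k → (k * 2 C k) * (k * 2 C k) * (1 + 3 * k) ≤ 2 ^ (k * 2) * 2 ^ (k * 2)
[2kCk]²*[1+3k]≤[2^2k]² zero    = ≤-refl
[2kCk]²*[1+3k]≤[2^2k]² (suc k) =
  subst (λ c → c * c * (1 + 3 * suc k) ≤ 2 ^ (suc k * 2) * 2 ^ (suc k * 2))
        (sym ([2+2k]C[1+k]≡[1+2k]Ck+[1+2k]Ck k))
        (central-step k (k * 2 C k) (suc (k * 2) C k) (2 ^ (k * 2))
                      ([1+k]*[1+2k]Ck≡[1+2k]*2kCk k) ([2kCk]²*[1+3k]≤[2^2k]² k))

[2kCk]²*2k≤[2^2k]² : ∀ k → (k * 2 C k) * (k * 2 C k) * (k * 2) ≤ 2 ^ (k * 2) * 2 ^ (k * 2)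
[2kCk]²*2k≤[2^2k]² k = ≤-trans (*-monoʳ-≤ ((k * 2 C k) * (k * 2 C k)) 2k≤1+3k) ([2kCk]²*[1+3k]≤[2^2k]² k)
  where
  2k≤1+3k : k * 2 ≤ 1 + 3 * k
  2k≤1+3k = ≤-trans (m≤m+n (k * 2) (suc k)) (≤-reflexive (solve (k ∷ [])))

halve-central-bound : ∀ k d q → (d + d) * (d + d) * (1 + 3 * suc k) ≤ 2 * (2 * q) * (2 * (2 * q)) →
                      d * d * suc (k * 2) ≤ 2 * q * (2 * q)
halve-central-bound k d q [2d]²[4+3k]≤[4q]² = *-cancelˡ-≤ 4 (begin
  4 * (d * d * suc (k * 2))                 ≤⟨ *-monoʳ-≤ 4 (*-monoʳ-≤ (d * d) (m≤m+n (suc (k * 2)) (3 + k))) ⟩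
  4 * (d * d * (suc (k * 2) + (3 + k)))     ≡⟨ solve (k ∷ d ∷ []) ⟩
  (d + d) * (d + d) * (1 + 3 * suc k)       ≤⟨ [2d]²[4+3k]≤[4q]² ⟩
  2 * (2 * q) * (2 * (2 * q))               ≡⟨ solve (q ∷ []) ⟩
  4 * (2 * q * (2 * q))                     ∎)
  where open ≤-Reasoning

[1+2kCk]²*[1+2k]≤[2^[1+2k]]² : ∀ k → (suc (k * 2) C k) * (suc (k * 2) C k) * suc (k * 2)
                                   ≤ 2 ^ suc (k * 2) * 2 ^ suc (k * 2)
[1+2kCk]²*[1+2k]≤[2^[1+2k]]² k = halve-central-bound k (suc (k * 2) C k) (2 ^ (k * 2))
  (subst (λ c → c * c * (1 + 3 * suc k) ≤ 2 ^ (suc k * 2) * 2 ^ (suc k * 2))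
         ([2+2k]C[1+k]≡[1+2k]Ck+[1+2k]Ck k) ([2kCk]²*[1+3k]≤[2^2k]² (suc k)))

nC[n/2]²*n≤[2^n]² : ∀ n → (n C (n / 2)) * (n C (n / 2)) * n ≤ 2 ^ n * 2 ^ n
nC[n/2]²*n≤[2^n]² n = subst P (sym (m≡m%n+[m/n]*n n 2)) (by-parity (n % 2) (m%n<n n 2))
  where
  P : ℕ → Set
  P m = (m C (n / 2)) * (m C (n / 2)) * m ≤ 2 ^ m * 2 ^ m
  by-parity : ∀ r → r < 2 → P (r + n / 2 * 2)
  by-parity 0 _ = [2kCk]²*2k≤[2^2k]² (n / 2)
  by-parity 1 _ = [1+2kCk]²*[1+2k]≤[2^[1+2k]]² (n / 2)
  by-parity (suc (suc _)) (s≤s (s≤s ()))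

atom : ∀ {n} → Literal n → Fin n
atom (pos a) = a
atom (neg a) = a

clauseAtoms : ∀ {n} → Clause n → List (Fin n)
clauseAtoms c = head c ∷ map atom (body c)

atoms : ∀ {n} → Program n → List (Fin n)
atoms = concatMap clauseAtoms

length-atoms : ∀ {n} (P : Program n) → length (atoms P) ≡ size P
length-atoms []      = refl
length-atoms (c ∷ P) =
  trans (length-++ (clauseAtoms c)) (cong₂ _+_ (cong suc (length-map atom (body c))) (length-atoms P))

Occurs⇒∈atoms : ∀ {n} {a : Fin n} {P} → Occurs a P → a ∈ atoms P
Occurs⇒∈atoms = ∈-concatMap⁺ clauseAtoms ∘ Any.map OccursClause⇒∈
  where
  OccursLit⇒≡ : ∀ {n} {a : Fin n} {l} → OccursLit a l → a ≡ atom l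
  OccursLit⇒≡ in-pos = refl
  OccursLit⇒≡ in-neg = refl
  OccursClause⇒∈ : ∀ {n} {a : Fin n} {c} → OccursClause a c → a ∈ clauseAtoms c
  OccursClause⇒∈ (in-head head≡a) = here (sym head≡a)
  OccursClause⇒∈ (in-body a∈body) = there (map⁺ (Any.map OccursLit⇒≡ a∈body))

covering⇒n≤length : ∀ {n} (xs : List (Fin n)) → (∀ i → i ∈ xs) → n ≤ length xs
covering⇒n≤length xs i∈xs = injective⇒≤ λ {i} {j} same-index →
  trans (lookup-index (i∈xs i)) (trans (cong (lookup xs) same-index) (sym (lookup-index (i∈xs j))))

AtomsAre⇒n≤size : ∀ {n} (P : Program n) → AtomsAre P → n ≤ size P
AtomsAre⇒n≤size P all-occur =
  subst (_ ≤_) (length-atoms P) (covering⇒n≤length (atoms P) (Occurs⇒∈atoms ∘ all-occur))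

sum-map-≤ : ∀ {A : Set} {f : A → ℕ} {b} (xs : List A) → (∀ x → f x ≤ b) → sum (map f xs) ≤ length xs * b
sum-map-≤ []       f≤b = z≤n
sum-map-≤ (x ∷ xs) f≤b = +-mono-≤ (f≤b x) (sum-map-≤ xs f≤b)

module _ {n} {P : Program n} {aux : Permutation′ n → List (Subset n)} (spec : StableAuxSpec P aux) where

  outputs-sound : ∀ 𝒮 {S} → S ∈ outputs 𝒮 aux → Stable P S
  outputs-sound 𝒮 S∈outputs with π , S∈auxπ ← satisfied (∈-concatMap⁻ aux {𝒮} S∈outputs) =
    proj₂ (proj₂ (proj₁ (spec π _) S∈auxπ))

  outputs-complete : ∀ 𝒮 {S j} → Any (λ π → S ≡ suffix π j) 𝒮 → Stable P S → S ∈ outputs 𝒮 aux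
  outputs-complete 𝒮 {S} {j} S-suffix stable =
    ∈-concatMap⁺ aux (Any.map (λ {π} S≡suffix → proj₂ (spec π S) j S≡suffix stable) S-suffix)

squared-bound : ∀ {T n Y} L K m → T ≤ L * (K * m) → L * L * n ≤ Y → T * T * n ≤ K * K * (m * m) * Y
squared-bound {T} {n} {Y} L K m T≤LKm L²n≤Y = begin
  T * T * n                       ≤⟨ *-monoˡ-≤ n (*-mono-≤ T≤LKm T≤LKm) ⟩
  L * (K * m) * (L * (K * m)) * n ≡⟨ solve (L ∷ K ∷ m ∷ n ∷ []) ⟩
  K * K * (m * m) * (L * L * n)   ≤⟨ *-monoʳ-≤ (K * K * (m * m)) L²n≤Y ⟩
  K * K * (m * m) * Y             ∎
  where open ≤-Reasoning

proposition5 : (c₁ c₂ : ℕ) → ∃ λ K →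
    (n : ℕ) → 1 ≤ n →
    (P : Program n) → AtomsAre P →
    (𝒮 : List (Permutation′ n)) → Full 𝒮 → length 𝒮 ≡ n C (n / 2) → AllPairs Distinct 𝒮 →
    (aux : Permutation′ n → List (Subset n)) → StableAuxSpec P aux →
    (genTime auxTime : Permutation′ n → ℕ) →
    (∀ π → genTime π ≤ c₁ * n) →
    (∀ π → auxTime π ≤ c₂ * size P) →
    ((∀ (S : Subset n) → (S ∈ outputs 𝒮 aux) ⇔ Stable P S)
     × (runningTime 𝒮 genTime auxTime * runningTime 𝒮 genTime auxTime * n
         ≤ K * K * (size P * size P) * (2 ^ n * 2 ^ n)))
proposition5 c₁ c₂ = c₁ + c₂ , λ n _ P all-occur 𝒮 full |𝒮|≡ _ aux spec genTime auxTime gen≤ aux≤ →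
  let m        = size P
      step≤ π  = begin
        genTime π + auxTime π ≤⟨ +-mono-≤ (≤-trans (gen≤ π) (*-monoʳ-≤ c₁ (AtomsAre⇒n≤size P all-occur))) (aux≤ π) ⟩
        c₁ * m + c₂ * m       ≡⟨ *-distribʳ-+ m c₁ c₂ ⟨
        (c₁ + c₂) * m         ∎
      |𝒮|²n≤4ⁿ = subst (λ L → L * L * n ≤ 2 ^ n * 2 ^ n) (sym |𝒮|≡) (nC[n/2]²*n≤[2^n]² n)
  in (λ S → mk⇔ (outputs-sound spec 𝒮) (outputs-complete spec 𝒮 (full S)))
   , squared-bound (length 𝒮) (c₁ + c₂) m (sum-map-≤ 𝒮 step≤) |𝒮|²n≤4ⁿ
  where open ≤-Reasoning
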